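{- For every integer $m\ge 4$, there is a bipartite graph $G$ with $\mathrm{lbp}(G)=\mathrm{lbc}(G)=2$ and $\mathrm{bp}(G)=\mathrm{bc}(G)=m$, such that $G$ has no $(m-1)$-local $m$-cover.
   Context: A biclique of a graph $G$ is a complete bipartite subgraph of $G$. A biclique cover of $G$ is a collection of bicliques of $G$ whose edge sets have union $E(G)$; a biclique partition is a collection of bicliques whose edge sets partition $E(G)$. A cover is an $m$-cover if it contains at most $m$ bicliques; a cover or partition is $r$-local if every vertex lies in at most $r$ of its bicliques. $\mathrm{bc}(G)$ (resp. $\mathrm{bp}(G)$) is the least number of bicliques in a biclique cover (resp. partition) of $G$; $\mathrm{lbc}(G)$ (resp. $\mathrm{lbp}(G)$) is the least $r$ such that $G$ has an $r$-local biclique cover (resp. partition). -}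

module Defs where

open import Data.Nat using (ℕ; zero; suc; _≤_; _<_; _∸_)
open import Data.Fin using (Fin; zero; suc)
open import Data.Bool using (Bool; true; false; T; _∨_; if_then_else_)
open import Data.Product using (Σ; ∃; ∃-syntax; _×_; _,_)
open import Data.Sum using (_⊎_)
open import Relation.Binary.PropositionalEquality using (_≡_; _≢_)

record Graph : Set where
  field
    n     : ℕ
    adj   : Fin n → Fin n → Bool
    sym   : ∀ u v → adj u v ≡ adj v u
    irrefl : ∀ v → adj v v ≡ false
open Graph public

Bipartite : Graph → Set
Bipartite G = Σ (Fin (n G) → Bool) λ c → ∀ u v → T (adj G u v) → c u ≢ c v

-- A biclique of G: two nonempty vertex sets L, R with every vertex of L
-- adjacent to every vertex of R (a complete bipartite subgraph K_{|L|,|R|};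
-- disjointness of L and R follows from irreflexivity).
record Biclique (G : Graph) : Set where
  field
    L : Fin (n G) → Bool
    R : Fin (n G) → Bool
    L-nonempty : ∃[ v ] T (L v)
    R-nonempty : ∃[ v ] T (R v)
    complete : ∀ u v → T (L u) → T (R v) → T (adj G u v)
open Biclique public

EdgeIn : {G : Graph} → Biclique G → Fin (n G) → Fin (n G) → Set
EdgeIn B u v = (T (L B u) × T (R B v)) ⊎ (T (L B v) × T (R B u))

VertexIn : {G : Graph} → Biclique G → Fin (n G) → Bool
VertexIn B v = L B v ∨ R B v

Collection : Graph → ℕ → Set
Collection G k = Fin k → Biclique G

IsCover : {G : Graph} {k : ℕ} → Collection G k → Set
IsCover {G} {k} C = ∀ u v → T (adj G u v) → ∃[ i ] EdgeIn (C i) u v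

IsPartition : {G : Graph} {k : ℕ} → Collection G k → Set
IsPartition {G} {k} C =
  ∀ u v → T (adj G u v) →
    (∃[ i ] EdgeIn (C i) u v) × (∀ i j → EdgeIn (C i) u v → EdgeIn (C j) u v → i ≡ j)

count : {k : ℕ} → (Fin k → Bool) → ℕ
count {zero} f = 0
count {suc k} f = (if f zero then 1 else 0) Data.Nat.+ count (λ i → f (suc i))

IsLocal : {G : Graph} {k : ℕ} → ℕ → Collection G k → Set
IsLocal {G} r C = ∀ (v : Fin (n G)) → count (λ i → VertexIn (C i) v) ≤ r

HasCoverOfSize HasPartitionOfSize : Graph → ℕ → Set
HasCoverOfSize G k = Σ (Collection G k) IsCover
HasPartitionOfSize G k = Σ (Collection G k) IsPartition

HasLocalCover HasLocalPartition : Graph → ℕ → Set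
HasLocalCover G r = ∃[ k ] Σ (Collection G k) λ C → IsCover C × IsLocal r C
HasLocalPartition G r = ∃[ k ] Σ (Collection G k) λ C → IsPartition C × IsLocal r C

IsLeast : (ℕ → Set) → ℕ → Set
IsLeast P x = P x × (∀ y → P y → x ≤ y)

bc≡ bp≡ lbc≡ lbp≡ : Graph → ℕ → Set
bc≡ G = IsLeast (HasCoverOfSize G)
bp≡ G = IsLeast (HasPartitionOfSize G)
lbc≡ G = IsLeast (HasLocalCover G)
lbp≡ G = IsLeast (HasLocalPartition G)

HasLocalBoundedCover : Graph → ℕ → ℕ → Set
HasLocalBoundedCover G r m =
  ∃[ k ] k ≤ m × Σ (Collection G k) λ C → IsCover C × IsLocal r C

-- The witness is the spider S_m (any m ≥ 2 works): a centre c joined to inner vertices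
-- a₀ … a_{m-1}, each aᵢ carrying a pendant outer vertex bᵢ.  It is a tree,
-- hence bipartite, and has the following covers:
--   * the m "leg" bicliques {aᵢ} × {c , bᵢ} partition E(S_m), so bp, bc ≤ m;
--   * the star {c} × {a₀ … a_{m-1}} with the m edges {aᵢ} × {bᵢ} is a
--     2-local partition, so lbp, lbc ≤ 2.
-- The lower bounds come from three facts valid in every graph, proved first:
--   * two edges p q and r s of one biclique force p to be adjacent to r or s;
--   * hence an induced matching aᵢbᵢ of size m needs m bicliques, and if a
--     cover uses at most m of them, a vertex adjacent to every aᵢ lies in all
--     of them (by injective ⇒ surjective on Fin), so the cover is not
--     (m-1)-local;
--   * along an induced path x y z w no cover is 1-local.
-- The spider has such a matching (aᵢbᵢ with hub c) and the induced path
-- b₀ a₀ c a₁, which gives bp = bc = m, lbp = lbc = 2 and the last claim.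
module Submission where

open import Defs
open import Data.Nat using (ℕ; _≤_; _∸_)
open import Data.Product using (Σ; _×_)
open import Relation.Nullary using (¬_)

open import Data.Nat.Base using (zero; suc; _+_; z≤n; s≤s; NonZero)
open import Data.Nat.Properties
  using (≤-refl; ≤-trans; ≤-reflexive; n≤1+n; 1+n≰n; m≤pred[n]⇒suc[m]≤n)
open import Data.Fin.Base using (Fin; zero; suc; splitAt; _↑ˡ_; _↑ʳ_)
open import Data.Fin.Properties
  using (_≟_; any?; injective⇒≤; suc-injective; 0≢1+n; splitAt-↑ˡ; splitAt-↑ʳ)
open import Data.Bool.Base using (Bool; true; false; T; _∨_)
open import Data.Bool.Properties using (T-∨; ∨-identityʳ)
open import Data.Unit.Base using (tt)
open import Data.Empty using (⊥; ⊥-elim)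
open import Data.Sum.Base using (_⊎_; inj₁; inj₂; [_,_]′; swap)
open import Data.Product.Base using (_,_; proj₁; proj₂; ∃-syntax)
open import Function.Base using (_∘_)
open import Function.Bundles using (Equivalence)
open import Function.Definitions using (Injective)
open import Relation.Nullary.Decidable using (yes; no; ⌊_⌋; toWitness; fromWitness)
open import Relation.Binary.PropositionalEquality
  using (_≡_; _≢_; refl; trans; cong; subst)
  renaming (sym to ≡-sym)

count-head : ∀ {k} (f : Fin (suc k) → Bool) → T (f zero) →
             count f ≡ suc (count (f ∘ suc))
count-head f p with f zero
... | true = refl

count-tail≤ : ∀ {k} (f : Fin (suc k) → Bool) → count (f ∘ suc) ≤ count f
count-tail≤ f with f zero
... | true  = n≤1+n _
... | false = ≤-refl

count-pos : ∀ {k} (f : Fin k → Bool) (j : Fin k) → T (f j) → 1 ≤ count f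
count-pos f zero    p rewrite count-head f p = s≤s z≤n
count-pos f (suc j) p = ≤-trans (count-pos (f ∘ suc) j p) (count-tail≤ f)

count-none : ∀ {k} (f : Fin k → Bool) → (∀ i → ¬ T (f i)) → count f ≡ 0
count-none {zero}  f none = refl
count-none {suc k} f none with f zero | none zero
... | true  | ¬p = ⊥-elim (¬p tt)
... | false | _  = count-none (f ∘ suc) (none ∘ suc)

count-all : ∀ {k} (f : Fin k → Bool) → (∀ i → T (f i)) → count f ≡ k
count-all {zero}  f all = refl
count-all {suc k} f all rewrite count-head f (all zero) =
  cong suc (count-all (f ∘ suc) (all ∘ suc))

count-≤1 : ∀ {k} (f : Fin k → Bool) →
           (∀ i j → T (f i) → T (f j) → i ≡ j) → count f ≤ 1
count-≤1 {zero}  f unique = z≤n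
count-≤1 {suc k} f unique with f zero | unique zero
... | true  | unique₀ =
  s≤s (≤-reflexive (count-none (f ∘ suc) (λ i p → 0≢1+n (unique₀ (suc i) tt p))))
... | false | _ = count-≤1 (f ∘ suc) (λ i j p q → suc-injective (unique (suc i) (suc j) p q))

count-≤1⇒unique : ∀ {k} (f : Fin k → Bool) → count f ≤ 1 →
                  ∀ i j → T (f i) → T (f j) → i ≡ j
count-≤1⇒unique f c zero    zero    p q = refl
count-≤1⇒unique f c zero    (suc j) p q = ⊥-elim (2≰1 (≤-trans two≤count c))
  where two≤count : 2 ≤ count f
        two≤count = ≤-trans (s≤s (count-pos (f ∘ suc) j q)) (≤-reflexive (≡-sym (count-head f p)))
        2≰1 : ¬ 2 ≤ 1
        2≰1 (s≤s ())
count-≤1⇒unique f c (suc i) zero    p q = ≡-sym (count-≤1⇒unique f c zero (suc i) q p)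
count-≤1⇒unique f c (suc i) (suc j) p q =
  cong suc (count-≤1⇒unique (f ∘ suc) (≤-trans (count-tail≤ f) c) i j p q)

unique-index : ∀ {k} {E : Fin k → Set} (l : Fin k) → (∀ i → E i → i ≡ l) →
               ∀ i j → E i → E j → i ≡ j
unique-index l pinned i j p q = trans (pinned i p) (≡-sym (pinned j q))

-- An injection Fin m → Fin k with k ≤ m is onto: a missed point would
-- extend it to an injection Fin (1 + m) → Fin k.
injective⇒surjective : ∀ {m k} → k ≤ m → (f : Fin m → Fin k) →
                       Injective _≡_ _≡_ f → ∀ j → ∃[ i ] f i ≡ j
injective⇒surjective {m} {k} k≤m f f-injective j with any? (λ i → f i ≟ j)
... | yes hit  = hit
... | no  miss = ⊥-elim (1+n≰n (≤-trans (injective⇒≤ extension-injective) k≤m))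
  where
  extension : Fin (suc m) → Fin k
  extension zero    = j
  extension (suc i) = f i
  extension-injective : Injective _≡_ _≡_ extension
  extension-injective {zero}  {zero}  _ = refl
  extension-injective {zero}  {suc i} e = ⊥-elim (miss (i , ≡-sym e))
  extension-injective {suc i} {zero}  e = ⊥-elim (miss (i , e))
  extension-injective {suc i} {suc j} e = cong suc (f-injective e)

module _ {G : Graph} (B : Biclique G) where

  EdgeIn-sym : ∀ {u v} → EdgeIn B u v → EdgeIn B v u
  EdgeIn-sym (inj₁ e) = inj₂ e
  EdgeIn-sym (inj₂ e) = inj₁ e

  EdgeIn⇒VertexIn : ∀ {u v} → EdgeIn B u v → T (VertexIn B u)
  EdgeIn⇒VertexIn (inj₁ (u∈L , _)) = Equivalence.from T-∨ (inj₁ u∈L)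
  EdgeIn⇒VertexIn (inj₂ (_ , u∈R)) = Equivalence.from T-∨ (inj₂ u∈R)

  -- If p q and r s are edges of B, then p is on one side and exactly one of
  -- r, s is on the other side, so p is adjacent to r or to s.
  biclique-link : ∀ {p q r s} → EdgeIn B p q → EdgeIn B r s →
                  T (adj G p r) ⊎ T (adj G p s)
  biclique-link (inj₁ (p∈L , _)) (inj₁ (_ , s∈R)) = inj₂ (complete B _ _ p∈L s∈R)
  biclique-link (inj₁ (p∈L , _)) (inj₂ (_ , r∈R)) = inj₁ (complete B _ _ p∈L r∈R)
  biclique-link (inj₂ (_ , p∈R)) (inj₁ (r∈L , _)) =
    inj₁ (subst T (Graph.sym G _ _) (complete B _ _ r∈L p∈R))
  biclique-link (inj₂ (_ , p∈R)) (inj₂ (s∈L , _)) =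
    inj₂ (subst T (Graph.sym G _ _) (complete B _ _ s∈L p∈R))

  separated : ∀ {p q r s} → EdgeIn B p q → EdgeIn B r s →
              ¬ T (adj G p r) → ¬ T (adj G p s) → ⊥
  separated e f ¬pr ¬ps = [ ¬pr , ¬ps ]′ (biclique-link e f)

partition⇒cover : ∀ {G k} (C : Collection G k) → IsPartition C → IsCover C
partition⇒cover C partition u v e = proj₁ (partition u v e)

-- Along an induced path x y z w (x adjacent to neither z nor w) no cover is
-- 1-local: the bicliques of x y, y z and z w would coincide (they share y,
-- resp. z), contradicting `separated`.
induced-path⇒no-1-local : ∀ {G} {x y z w : Fin (n G)} →
  T (adj G x y) → T (adj G y z) → T (adj G z w) →
  ¬ T (adj G x z) → ¬ T (adj G x w) →
  ∀ {k} (C : Collection G k) → IsCover C → ¬ IsLocal 1 C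
induced-path⇒no-1-local {G} {x} {y} {z} {w} xy yz zw ¬xz ¬xw C cover local =
  separated (C i) xy∈i (subst (λ t → EdgeIn (C t) z w) (≡-sym i≡l) zw∈l) ¬xz ¬xw
  where
  i = proj₁ (cover x y xy)
  j = proj₁ (cover y z yz)
  l = proj₁ (cover z w zw)
  xy∈i = proj₂ (cover x y xy)
  yz∈j = proj₂ (cover y z yz)
  zw∈l = proj₂ (cover z w zw)
  i≡l : i ≡ l
  i≡l = trans
    (count-≤1⇒unique _ (local y) i j (EdgeIn⇒VertexIn (C i) (EdgeIn-sym (C i) xy∈i))
                                     (EdgeIn⇒VertexIn (C j) yz∈j))
    (count-≤1⇒unique _ (local z) j l (EdgeIn⇒VertexIn (C j) (EdgeIn-sym (C j) yz∈j))
                                     (EdgeIn⇒VertexIn (C l) zw∈l))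

local-partition⇒local-cover : ∀ {G r} → HasLocalPartition G r → HasLocalCover G r
local-partition⇒local-cover (k , C , partition , local) = k , C , partition⇒cover C partition , local

partition⇒cover-of-size : ∀ {G k} → HasPartitionOfSize G k → HasCoverOfSize G k
partition⇒cover-of-size (C , partition) = C , partition⇒cover C partition

module _ {G : Graph} (no-1-local : ∀ {k} (C : Collection G k) → IsCover C → ¬ IsLocal 1 C) where

  two≤locality : ∀ r {k} (C : Collection G k) → IsCover C → IsLocal r C → 2 ≤ r
  two≤locality zero          C cover local = ⊥-elim (no-1-local C cover (λ v → ≤-trans (local v) z≤n))
  two≤locality (suc zero)    C cover local = ⊥-elim (no-1-local C cover local)
  two≤locality (suc (suc r)) C cover local = s≤s (s≤s z≤n)

  lbc≡2 : HasLocalCover G 2 → lbc≡ G 2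
  lbc≡2 two-local = two-local , λ { r (_ , C , cover , local) → two≤locality r C cover local }

  lbp≡2 : HasLocalPartition G 2 → lbp≡ G 2
  lbp≡2 two-local = two-local , λ { r (_ , C , partition , local) →
                                   two≤locality r C (partition⇒cover C partition) local }

module _ {G : Graph} {m : ℕ} (lower : ∀ {k} (C : Collection G k) → IsCover C → m ≤ k) where

  bc≡ₘ : HasCoverOfSize G m → bc≡ G m
  bc≡ₘ cover = cover , λ { k (C , c) → lower C c }

  bp≡ₘ : HasPartitionOfSize G m → bp≡ G m
  bp≡ₘ partition = partition , λ { k (C , p) → lower C (partition⇒cover C p) }

module InducedMatching {G : Graph} {m : ℕ} (a b : Fin m → Fin (n G))
  (matched : ∀ i → T (adj G (a i) (b i)))
  (apart : ∀ i j → i ≢ j → ¬ T (adj G (a i) (a j)) × ¬ T (adj G (a i) (b j)))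
  where

  matching-biclique : ∀ (B : Biclique G) {i j x} →
                      EdgeIn B (a i) x → EdgeIn B (a j) (b j) → i ≡ j
  matching-biclique B {i} {j} e f with i ≟ j
  ... | yes i≡j = i≡j
  ... | no  i≢j = ⊥-elim (separated B e f (proj₁ (apart i j i≢j)) (proj₂ (apart i j i≢j)))

  module _ {k} (C : Collection G k) (cover : IsCover C) where

    matchIndex : Fin m → Fin k
    matchIndex i = proj₁ (cover (a i) (b i) (matched i))

    matchIndex-edge : ∀ i → EdgeIn (C (matchIndex i)) (a i) (b i)
    matchIndex-edge i = proj₂ (cover (a i) (b i) (matched i))

    matchIndex-injective : Injective _≡_ _≡_ matchIndex
    matchIndex-injective {i} {j} eq =
      matching-biclique (C (matchIndex j))
        (subst (λ t → EdgeIn (C t) (a i) (b i)) eq (matchIndex-edge i)) (matchIndex-edge j)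

    cover-size : m ≤ k
    cover-size = injective⇒≤ matchIndex-injective

    -- With at most m bicliques, matchIndex is onto, so any biclique holding
    -- an edge at aᵢ is the one chosen for aᵢbᵢ ...
    edge-at-matched : k ≤ m → ∀ l {i x} → EdgeIn (C l) (a i) x → l ≡ matchIndex i
    edge-at-matched k≤m l e with injective⇒surjective k≤m matchIndex matchIndex-injective l
    ... | j , refl = cong matchIndex (≡-sym (matching-biclique (C (matchIndex j)) e (matchIndex-edge j)))

    hub-everywhere : k ≤ m → ∀ h → (∀ i → T (adj G h (a i))) → ∀ l → T (VertexIn (C l) h)
    hub-everywhere k≤m h hub l with injective⇒surjective k≤m matchIndex matchIndex-injective l
    ... | i , refl = subst (λ t → T (VertexIn (C t) h))
                           (edge-at-matched k≤m l′ (EdgeIn-sym (C l′) hai∈l′))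
                           (EdgeIn⇒VertexIn (C l′) hai∈l′)
      where
      l′ = proj₁ (cover h (a i) (hub i))
      hai∈l′ = proj₂ (cover h (a i) (hub i))

  -- If some vertex h is adjacent to every aᵢ, there is no (m-1)-local m-cover:
  -- h would lie in all k ≥ m bicliques.
  no-local-small-cover : {{_ : NonZero m}} → ∀ h → (∀ i → T (adj G h (a i))) →
                         ¬ HasLocalBoundedCover G (m ∸ 1) m
  no-local-small-cover h hub (k , k≤m , C , cover , local) =
    1+n≰n (m≤pred[n]⇒suc[m]≤n (≤-trans (cover-size C cover) k≤count))
    where
    k≤count : k ≤ m ∸ 1
    k≤count = ≤-trans (≤-reflexive (≡-sym (count-all _ (hub-everywhere C cover k≤m h hub))))
                      (local h)

data Vertex (m : ℕ) : Set where
  centre : Vertex m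
  inner outer : Fin m → Vertex m

-- The spider with m = 2 + m₂ legs (two legs are needed for the induced path
-- b₀ a₀ c a₁).
module Spider (m₂ : ℕ) where

  m : ℕ
  m = suc (suc m₂)

  _≡ᵇ_ : Fin m → Fin m → Bool
  i ≡ᵇ j = ⌊ i ≟ j ⌋

  ≡ᵇ⇒≡ : ∀ {i j} → T (i ≡ᵇ j) → i ≡ j
  ≡ᵇ⇒≡ {i} {j} = toWitness {a? = i ≟ j}

  ≡⇒≡ᵇ : ∀ {i j} → i ≡ j → T (i ≡ᵇ j)
  ≡⇒≡ᵇ {i} {j} = fromWitness {a? = i ≟ j}

  spiderAdj : Vertex m → Vertex m → Bool
  spiderAdj centre    (inner _) = true
  spiderAdj (inner _) centre    = true
  spiderAdj (inner i) (outer j) = i ≡ᵇ j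
  spiderAdj (outer j) (inner i) = i ≡ᵇ j
  spiderAdj _         _         = false

  spiderAdj-sym : ∀ x y → spiderAdj x y ≡ spiderAdj y x
  spiderAdj-sym centre    centre    = refl
  spiderAdj-sym centre    (inner _) = refl
  spiderAdj-sym centre    (outer _) = refl
  spiderAdj-sym (inner _) centre    = refl
  spiderAdj-sym (inner _) (inner _) = refl
  spiderAdj-sym (inner _) (outer _) = refl
  spiderAdj-sym (outer _) centre    = refl
  spiderAdj-sym (outer _) (inner _) = refl
  spiderAdj-sym (outer _) (outer _) = refl

  spiderAdj-irrefl : ∀ x → spiderAdj x x ≡ false
  spiderAdj-irrefl centre    = refl
  spiderAdj-irrefl (inner _) = refl
  spiderAdj-irrefl (outer _) = refl

  decode : Fin (suc (m + m)) → Vertex m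
  decode zero    = centre
  decode (suc v) = [ inner , outer ]′ (splitAt m v)

  encode : Vertex m → Fin (suc (m + m))
  encode centre    = zero
  encode (inner i) = suc (i ↑ˡ m)
  encode (outer i) = suc (m ↑ʳ i)

  decode-encode : ∀ x → decode (encode x) ≡ x
  decode-encode centre    = refl
  decode-encode (inner i) rewrite splitAt-↑ˡ m i m = refl
  decode-encode (outer i) rewrite splitAt-↑ʳ m m i = refl

  spider : Graph
  spider = record
    { n      = suc (m + m)
    ; adj    = λ u v → spiderAdj (decode u) (decode v)
    ; sym    = λ u v → spiderAdj-sym (decode u) (decode v)
    ; irrefl = λ v → spiderAdj-irrefl (decode v)
    }

  adj-encode : ∀ x y → adj spider (encode x) (encode y) ≡ spiderAdj x y
  adj-encode x y rewrite decode-encode x | decode-encode y = refl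

  adjacent : ∀ x y → T (spiderAdj x y) → T (adj spider (encode x) (encode y))
  adjacent x y = subst T (≡-sym (adj-encode x y))

  non-adjacent : ∀ x y → ¬ T (spiderAdj x y) → ¬ T (adj spider (encode x) (encode y))
  non-adjacent x y ¬xy = ¬xy ∘ subst T (adj-encode x y)

  bipartite : Bipartite spider
  bipartite = colour ∘ decode , λ u v → proper (decode u) (decode v)
    where
    colour : Vertex m → Bool
    colour centre    = true
    colour (inner _) = false
    colour (outer _) = true
    proper : ∀ x y → T (spiderAdj x y) → colour x ≢ colour y
    proper centre    (inner _) _ ()
    proper (inner _) centre    _ ()
    proper (inner _) (outer _) _ ()
    proper (outer _) (inner _) _ ()

  biclique : (Ls Rs : Vertex m → Bool) → ∃[ x ] T (Ls x) → ∃[ y ] T (Rs y) →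
             (∀ x y → T (Ls x) → T (Rs y) → T (spiderAdj x y)) → Biclique spider
  biclique Ls Rs (x , x∈L) (y , y∈R) complete′ = record
    { L          = Ls ∘ decode
    ; R          = Rs ∘ decode
    ; L-nonempty = encode x , subst (T ∘ Ls) (≡-sym (decode-encode x)) x∈L
    ; R-nonempty = encode y , subst (T ∘ Rs) (≡-sym (decode-encode y)) y∈R
    ; complete   = λ u v → complete′ (decode u) (decode v)
    }

  Joins : (Ls Rs : Vertex m → Bool) → Vertex m → Vertex m → Set
  Joins Ls Rs x y = (T (Ls x) × T (Rs y)) ⊎ (T (Ls y) × T (Rs x))

  Partitioned : ∀ {k} (Ls Rs : Fin k → Vertex m → Bool) → Vertex m → Vertex m → Set
  Partitioned Ls Rs x y =
    (∃[ i ] Joins (Ls i) (Rs i) x y) × (∀ i j → Joins (Ls i) (Rs i) x y → Joins (Ls j) (Rs j) x y → i ≡ j)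

  Partitioned-sym : ∀ {k} {Ls Rs : Fin k → Vertex m → Bool} {x y} →
                    Partitioned Ls Rs x y → Partitioned Ls Rs y x
  Partitioned-sym ((i , J) , unique) = (i , swap J) , λ i j p q → unique i j (swap p) (swap q)

  -- Every edge has an inner endpoint, so it suffices to check edges aⱼ w.
  partitioned-from-inner : ∀ {k} (Ls Rs : Fin k → Vertex m → Bool) →
    (∀ j w → T (spiderAdj (inner j) w) → Partitioned Ls Rs (inner j) w) →
    ∀ x y → T (spiderAdj x y) → Partitioned Ls Rs x y
  partitioned-from-inner Ls Rs at-inner (inner j) w         e = at-inner j w e
  partitioned-from-inner Ls Rs at-inner centre    (inner j) e =
    Partitioned-sym {Ls = Ls} {Rs} (at-inner j centre e)
  partitioned-from-inner Ls Rs at-inner (outer i) (inner j) e =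
    Partitioned-sym {Ls = Ls} {Rs} (at-inner j (outer i) e)

  isCentre isAnyInner : Vertex m → Bool
  isCentre centre = true
  isCentre _      = false
  isAnyInner (inner _) = true
  isAnyInner _         = false

  isInner isOuter : Fin m → Vertex m → Bool
  isInner i (inner j) = i ≡ᵇ j
  isInner i _         = false
  isOuter i (outer j) = i ≡ᵇ j
  isOuter i _         = false

  centreOrOuter : Fin m → Vertex m → Bool
  centreOrOuter i centre = true
  centreOrOuter i x      = isOuter i x

  leg-complete : ∀ i x y → T (isInner i x) → T (centreOrOuter i y) → T (spiderAdj x y)
  leg-complete i (inner j) centre    _   _   = tt
  leg-complete i (inner j) (outer l) i≡j i≡l = ≡⇒≡ᵇ (trans (≡-sym (≡ᵇ⇒≡ i≡j)) (≡ᵇ⇒≡ i≡l))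
  leg-complete i (inner j) (inner l) _   ()
  leg-complete i centre    _         ()  _
  leg-complete i (outer j) _         ()  _

  legs : Collection spider m
  legs i = biclique (isInner i) (centreOrOuter i) (inner i , ≡⇒≡ᵇ refl) (centre , tt) (leg-complete i)

  leg-pinned : ∀ j w i → Joins (isInner i) (centreOrOuter i) (inner j) w → i ≡ j
  leg-pinned j w i (inj₁ (i≡j , _)) = ≡ᵇ⇒≡ i≡j
  leg-pinned j w i (inj₂ (_ , ()))

  legs-at-inner : ∀ j w → T (spiderAdj (inner j) w) →
                  Partitioned isInner centreOrOuter (inner j) w
  legs-at-inner j centre    _ = (j , inj₁ (≡⇒≡ᵇ refl , tt)) , unique-index j (leg-pinned j centre)
  legs-at-inner j (outer l) e = (j , inj₁ (≡⇒≡ᵇ refl , e))  , unique-index j (leg-pinned j (outer l))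

  legs-partition : HasPartitionOfSize spider m
  legs-partition =
    legs , λ u v → partitioned-from-inner isInner centreOrOuter legs-at-inner (decode u) (decode v)

  starL starR : Fin (suc m) → Vertex m → Bool
  starL zero    = isCentre
  starL (suc i) = isInner i
  starR zero    = isAnyInner
  starR (suc i) = isOuter i

  star-left : ∀ q → ∃[ x ] T (starL q x)
  star-left zero    = centre , tt
  star-left (suc i) = inner i , ≡⇒≡ᵇ refl

  star-right : ∀ q → ∃[ y ] T (starR q y)
  star-right zero    = inner zero , tt
  star-right (suc i) = outer i , ≡⇒≡ᵇ refl

  star-complete : ∀ q x y → T (starL q x) → T (starR q y) → T (spiderAdj x y)
  star-complete zero    centre    (inner _) _   _   = tt
  star-complete (suc i) (inner j) (outer l) i≡j i≡l = ≡⇒≡ᵇ (trans (≡-sym (≡ᵇ⇒≡ i≡j)) (≡ᵇ⇒≡ i≡l))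
  star-complete zero    centre    centre    _   ()
  star-complete zero    centre    (outer _) _   ()
  star-complete zero    (inner _) _         ()  _
  star-complete zero    (outer _) _         ()  _
  star-complete (suc i) (inner j) centre    _   ()
  star-complete (suc i) (inner j) (inner _) _   ()
  star-complete (suc i) centre    _         ()  _
  star-complete (suc i) (outer _) _         ()  _

  starMatching : Collection spider (suc m)
  starMatching q = biclique (starL q) (starR q) (star-left q) (star-right q) (star-complete q)

  star-at-inner : ∀ j w → T (spiderAdj (inner j) w) → Partitioned starL starR (inner j) w
  star-at-inner j centre    _ = (zero , inj₂ (tt , tt)) , unique-index zero pinned
    where pinned : ∀ q → Joins (starL q) (starR q) (inner j) centre → q ≡ zero
          pinned zero    _                = refl
          pinned (suc i) (inj₁ (_ , ()))
          pinned (suc i) (inj₂ (() , _))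
  star-at-inner j (outer l) e = (suc j , inj₁ (≡⇒≡ᵇ refl , e)) , unique-index (suc j) pinned
    where pinned : ∀ q → Joins (starL q) (starR q) (inner j) (outer l) → q ≡ suc j
          pinned zero    (inj₁ (() , _))
          pinned zero    (inj₂ (() , _))
          pinned (suc i) (inj₁ (i≡j , _)) = cong suc (≡ᵇ⇒≡ i≡j)
          pinned (suc i) (inj₂ (() , _))

  starMatching-isPartition : IsPartition starMatching
  starMatching-isPartition u v =
    partitioned-from-inner starL starR star-at-inner (decode u) (decode v)

  -- c lies only in the star, aᵢ in the star and its matching edge, bᵢ only in
  -- its matching edge.
  star-local-at : ∀ x → count (λ q → starL q x ∨ starR q x) ≤ 2
  star-local-at centre    = s≤s (≤-trans (≤-reflexive c-only-in-star) z≤n)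
    where c-only-in-star : count (λ i → starL (suc i) centre ∨ starR (suc i) centre) ≡ 0
          c-only-in-star = count-none (λ i → starL (suc i) centre ∨ starR (suc i) centre) (λ _ ())
  star-local-at (inner j) =
    s≤s (count-≤1 _ (unique-index j (λ i i≡j → ≡ᵇ⇒≡ (subst T (∨-identityʳ _) i≡j))))
  star-local-at (outer j) = ≤-trans (count-≤1 _ (unique-index j (λ i → ≡ᵇ⇒≡))) (n≤1+n 1)

  starMatching-partition : HasLocalPartition spider 2
  starMatching-partition = suc m , starMatching , starMatching-isPartition , star-local-at ∘ decode

  legA legB : Fin m → Fin (n spider)
  legA i = encode (inner i)
  legB i = encode (outer i)

  legs-matched : ∀ i → T (adj spider (legA i) (legB i))
  legs-matched i = adjacent (inner i) (outer i) (≡⇒≡ᵇ refl)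

  legs-apart : ∀ i j → i ≢ j →
               ¬ T (adj spider (legA i) (legA j)) × ¬ T (adj spider (legA i) (legB j))
  legs-apart i j i≢j =
    non-adjacent (inner i) (inner j) (λ ()) , non-adjacent (inner i) (outer j) (i≢j ∘ ≡ᵇ⇒≡)

  centre-hub : ∀ i → T (adj spider (encode centre) (legA i))
  centre-hub i = adjacent centre (inner i) tt

  spider-not-1-local : ∀ {k} (C : Collection spider k) → IsCover C → ¬ IsLocal 1 C
  spider-not-1-local =
    induced-path⇒no-1-local {spider} {encode b₀} {encode a₀} {encode centre} {encode a₁}
    (adjacent b₀ a₀ tt) (adjacent a₀ centre tt) (adjacent centre a₁ tt)
    (non-adjacent b₀ centre (λ ())) (non-adjacent b₀ a₁ (λ ()))
    where
    a₀ a₁ b₀ : Vertex m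
    a₀ = inner zero
    a₁ = inner (suc zero)
    b₀ = outer zero

mainTheorem9 : (m : ℕ) → 4 ≤ m →
    Σ Graph λ G → Bipartite G × lbp≡ G 2 × lbc≡ G 2 × bp≡ G m × bc≡ G m
    × ¬ HasLocalBoundedCover G (m ∸ 1) m
mainTheorem9 zero          ()
mainTheorem9 (suc zero)    (s≤s ())
mainTheorem9 (suc (suc m₂)) _ =
    spider
  , bipartite
  , lbp≡2 spider-not-1-local starMatching-partition
  , lbc≡2 spider-not-1-local (local-partition⇒local-cover starMatching-partition)
  , bp≡ₘ cover-size legs-partition
  , bc≡ₘ cover-size (partition⇒cover-of-size legs-partition)
  , no-local-small-cover (encode centre) centre-hub
  where
  open Spider m₂
  open InducedMatching {G = spider} legA legB legs-matched legs-apart
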